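{- Let $k$ be a positive integer and let $X$ be a non-empty subset of $\{0,1\}^k$. Then, for every $n \ge k$, the family of isometric copies of $X$ in $\{0,1\}^n$ contains an $|X|$-fold partition of $\{0,1\}^n$; that is, there is an assignment of non-negative integer weights to the isometric copies of $X$ in $\{0,1\}^n$ such that, for every $p \in \{0,1\}^n$, the sum of the weights of the copies containing $p$ equals $|X|$.
   Context: $\{0,1\}^n$ carries the Hamming distance ($d(x,y)$ = number of coordinates where $x,y$ differ). For $n \ge k$, $Y \subset \{0,1\}^n$ is an isometric copy of $X \subset \{0,1\}^k$ if $Y = \phi(X)$ for some distance-preserving map $\phi:\{0,1\}^k \to \{0,1\}^n$. -}

module Defs where

open import Data.Bool using (Bool; true; false; _xor_)
open import Data.Nat using (ℕ; zero; suc; _+_)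
open import Data.Vec using (Vec; []; _∷_)
open import Data.List using (List; length; filter)
open import Data.List.Relation.Unary.Any using (Any; any?)
open import Data.Product using (Σ; proj₁)
open import Relation.Binary.PropositionalEquality using (_≡_)
open import Relation.Nullary using (Dec)
import Data.Vec.Properties as VecP
import Data.Bool.Properties as BoolP

Cube : ℕ → Set
Cube k = Vec Bool k

hamming : ∀ {k} → Cube k → Cube k → ℕ
hamming [] [] = 0
hamming (a ∷ x) (b ∷ y) = (if' (a xor b)) + hamming x y
  where
  if' : Bool → ℕ
  if' true = 1
  if' false = 0

_≟C_ : ∀ {n} (p q : Cube n) → Dec (p ≡ q)
_≟C_ = VecP.≡-dec BoolP._≟_

IsIsometry : ∀ {k n} → (Cube k → Cube n) → Set
IsIsometry φ = ∀ x y → hamming (φ x) (φ y) ≡ hamming x y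

Isometry : ℕ → ℕ → Set
Isometry k n = Σ (Cube k → Cube n) IsIsometry

InCopy : ∀ {k n} → List (Cube k) → (Cube k → Cube n) → Cube n → Set
InCopy X φ p = Any (λ x → φ x ≡ p) X

inCopy? : ∀ {k n} (X : List (Cube k)) (φ : Cube k → Cube n) (p : Cube n) → Dec (InCopy X φ p)
inCopy? X φ p = any? (λ x → φ x ≟C p) X

-- A finite multiset of isometric copies φ(X) is given by a list of isometries
-- (the weight of a copy Y = number of list entries ψ with ψ(X) = Y).
-- coverCount X L p = sum of the weights of the copies containing p.
coverCount : ∀ {k n} → List (Cube k) → List (Isometry k n) → Cube n → ℕ
coverCount X L p = length (filter (λ ψ → inCopy? X (proj₁ ψ) p) L)

-- Zero-padding embeds {0,1}^k isometrically into {0,1}^n, say as φ, and every translation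
-- x ↦ t ⊕ φ x by a vector t ∈ {0,1}^n is again an isometry. Give each of these 2^n copies
-- of X weight one. The point p lies in the copy translated by t iff t ⊕ φ x = p for some
-- x ∈ X, i.e. iff t belongs to the translate p ⊕ φ(X); as translates of an injective image
-- that set has exactly |X| elements.
module Submission where

open import Defs
open import Data.Bool using (true; false; _xor_)
open import Data.Bool.Properties using (xor-assoc; xor-same; xor-identityʳ)
open import Data.Nat using (ℕ; zero; suc; _+_; _≤_; z≤n; s≤s)
open import Data.Vec using ([]; _∷_; zipWith; replicate)
open import Data.Vec.Properties using (∷-injective)
open import Data.List using (List; []; _∷_; [_]; length; map; filter; cartesianProductWith)
open import Data.List.Properties using (length-map)
open import Data.List.Membership.Propositional using (_∈_)
open import Data.List.Membership.Propositional.Properties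
  using (∈-filter⁺; ∈-filter⁻; ∈-cartesianProductWith⁺)
open import Data.List.Membership.Propositional.Properties.WithK using (unique∧set⇒bag)
open import Data.List.Relation.Unary.Any using (here; there)
import Data.List.Relation.Unary.Any as Any
import Data.List.Relation.Unary.Any.Properties as Any
open import Data.List.Relation.Unary.All using ([]; _∷_)
open import Data.List.Relation.Unary.Unique.Propositional using (Unique; []; _∷_)
import Data.List.Relation.Unary.Unique.Propositional.Properties as Unique
open import Data.List.Relation.Binary.BagAndSetEquality using (∼bag⇒↭)
open import Data.List.Relation.Binary.Permutation.Propositional.Properties using (↭-length)
open import Data.Product using (Σ; _,_; proj₁; proj₂)
open import Function using (_∘_; _⇔_; mk⇔; Equivalence)
open import Level using (Level)
open import Relation.Nullary using (yes; no)
open import Relation.Unary using (Pred; Decidable)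
open import Relation.Binary.PropositionalEquality
  using (_≡_; _≢_; refl; sym; trans; cong; cong₂; module ≡-Reasoning)

private
  variable
    a b p : Level
    A B : Set a

filter-map : {P : Pred B p} (P? : Decidable P) (f : A → B) (xs : List A) →
             filter P? (map f xs) ≡ map f (filter (P? ∘ f) xs)
filter-map P? f []       = refl
filter-map P? f (x ∷ xs) with P? (f x)
... | yes _ = cong (f x ∷_) (filter-map P? f xs)
... | no  _ = filter-map P? f xs

-- Both sides are duplicate-free lists with the same members, hence permutations of each other.
length-filter-complete : {P : Pred A p} (P? : Decidable P) {xs ys : List A} →
                         Unique xs → (∀ x → x ∈ xs) → Unique ys → (∀ x → P x ⇔ x ∈ ys) →
                         length (filter P? xs) ≡ length ys
length-filter-complete P? {xs} {ys} xs! xs-complete ys! P⇔∈ys =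
  ↭-length (∼bag⇒↭ (unique∧set⇒bag (Unique.filter⁺ P? xs!) ys! same-members))
  where
  same-members : ∀ {x} → x ∈ filter P? xs ⇔ x ∈ ys
  same-members {x} = mk⇔ (Equivalence.to (P⇔∈ys x) ∘ proj₂ ∘ ∈-filter⁻ P? {xs = xs})
                         (∈-filter⁺ P? (xs-complete x) ∘ Equivalence.from (P⇔∈ys x))

cubes : (n : ℕ) → List (Cube n)
cubes zero    = [ [] ]
cubes (suc n) = cartesianProductWith _∷_ (true ∷ false ∷ []) (cubes n)

cubes-unique : ∀ n → Unique (cubes n)
cubes-unique zero    = [] ∷ []
cubes-unique (suc n) =
  Unique.cartesianProductWith⁺ _∷_ ∷-injective bools-unique (cubes-unique n)
  where
  bools-unique : Unique (true ∷ false ∷ [])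
  bools-unique = ((λ ()) ∷ []) ∷ [] ∷ []

cubes-complete : ∀ {n} (p : Cube n) → p ∈ cubes n
cubes-complete []      = here refl
cubes-complete (b ∷ p) = ∈-cartesianProductWith⁺ _∷_ (bools-complete b) (cubes-complete p)
  where
  bools-complete : ∀ b → b ∈ true ∷ false ∷ []
  bools-complete true  = here refl
  bools-complete false = there (here refl)

infixl 6 _⊕_
_⊕_ : ∀ {n} → Cube n → Cube n → Cube n
_⊕_ = zipWith _xor_

⊕-cancelʳ : ∀ {n} (t u : Cube n) → t ⊕ u ⊕ u ≡ t
⊕-cancelʳ []      []      = refl
⊕-cancelʳ (a ∷ t) (b ∷ u) = cong₂ _∷_ xor-cancelʳ (⊕-cancelʳ t u)
  where
  open ≡-Reasoning
  xor-cancelʳ : (a xor b) xor b ≡ a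
  xor-cancelʳ = begin
    (a xor b) xor b ≡⟨ xor-assoc a b b ⟩
    a xor (b xor b) ≡⟨ cong (a xor_) (xor-same b) ⟩
    a xor false     ≡⟨ xor-identityʳ a ⟩
    a               ∎

hamming-refl : ∀ {n} (u : Cube n) → hamming u u ≡ 0
hamming-refl []          = refl
hamming-refl (true ∷ u)  = hamming-refl u
hamming-refl (false ∷ u) = hamming-refl u

hamming≡0⇒≡ : ∀ {n} (u v : Cube n) → hamming u v ≡ 0 → u ≡ v
hamming≡0⇒≡ []          []          _  = refl
hamming≡0⇒≡ (true ∷ u)  (true ∷ v)  eq = cong (true ∷_) (hamming≡0⇒≡ u v eq)
hamming≡0⇒≡ (false ∷ u) (false ∷ v) eq = cong (false ∷_) (hamming≡0⇒≡ u v eq)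
hamming≡0⇒≡ (true ∷ u)  (false ∷ v) ()
hamming≡0⇒≡ (false ∷ u) (true ∷ v)  ()

-- In each clause the heads a xor b and (t xor a) xor (t xor b) compute to the same bit.
hamming-⊕ˡ : ∀ {n} (t u v : Cube n) → hamming (t ⊕ u) (t ⊕ v) ≡ hamming u v
hamming-⊕ˡ []          []          []          = refl
hamming-⊕ˡ (false ∷ t) (_ ∷ u)     (_ ∷ v)     = cong₂ _+_ refl (hamming-⊕ˡ t u v)
hamming-⊕ˡ (true ∷ t)  (true ∷ u)  (_ ∷ v)     = cong₂ _+_ refl (hamming-⊕ˡ t u v)
hamming-⊕ˡ (true ∷ t)  (false ∷ u) (true ∷ v)  = cong₂ _+_ refl (hamming-⊕ˡ t u v)
hamming-⊕ˡ (true ∷ t)  (false ∷ u) (false ∷ v) = cong₂ _+_ refl (hamming-⊕ˡ t u v)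

isometry-injective : ∀ {k n} {φ : Cube k → Cube n} → IsIsometry φ →
                     ∀ {x y} → φ x ≡ φ y → x ≡ y
isometry-injective {φ = φ} φ-iso {x} {y} φx≡φy = hamming≡0⇒≡ x y (begin
  hamming x y         ≡⟨ sym (φ-iso x y) ⟩
  hamming (φ x) (φ y) ≡⟨ cong (hamming (φ x)) (sym φx≡φy) ⟩
  hamming (φ x) (φ x) ≡⟨ hamming-refl (φ x) ⟩
  0                   ∎)
  where open ≡-Reasoning

zeroPad : ∀ {k n} → k ≤ n → Cube k → Cube n
zeroPad {n = n} z≤n      []      = replicate n false
zeroPad         (s≤s k≤n) (a ∷ x) = a ∷ zeroPad k≤n x

zeroPad-isometry : ∀ {k n} (k≤n : k ≤ n) → IsIsometry (zeroPad k≤n)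
zeroPad-isometry {n = n} z≤n      []      []      = hamming-refl (replicate n false)
zeroPad-isometry         (s≤s k≤n) (a ∷ x) (b ∷ y) = cong₂ _+_ refl (zeroPad-isometry k≤n x y)

translate : ∀ {k n} → Isometry k n → Cube n → Isometry k n
translate (φ , φ-iso) t = (λ x → t ⊕ φ x) , λ x y → trans (hamming-⊕ˡ t (φ x) (φ y)) (φ-iso x y)

InCopy-translate⇔∈ : ∀ {k n} (φ : Isometry k n) (X : List (Cube k)) (p t : Cube n) →
                     InCopy X (proj₁ (translate φ t)) p ⇔ t ∈ map (proj₁ (translate φ p)) X
InCopy-translate⇔∈ (φ , _) X p t = mk⇔ (Any.map⁺ ∘ Any.map solve) (Any.map unsolve ∘ Any.map⁻)
  where
  solve : ∀ {x} → t ⊕ φ x ≡ p → t ≡ p ⊕ φ x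
  solve {x} eq = trans (sym (⊕-cancelʳ t (φ x))) (cong (_⊕ φ x) eq)
  unsolve : ∀ {x} → t ≡ p ⊕ φ x → t ⊕ φ x ≡ p
  unsolve {x} refl = ⊕-cancelʳ p (φ x)

coverCount-translates : ∀ {k n} (φ : Isometry k n) {X : List (Cube k)} → Unique X →
                        (p : Cube n) → coverCount X (map (translate φ) (cubes n)) p ≡ length X
coverCount-translates {n = n} φ {X} X! p = begin
  length (filter P? (map (translate φ) (cubes n)))
    ≡⟨ cong length (filter-map P? (translate φ) (cubes n)) ⟩
  length (map (translate φ) (filter (P? ∘ translate φ) (cubes n)))
    ≡⟨ length-map (translate φ) (filter (P? ∘ translate φ) (cubes n)) ⟩
  length (filter (P? ∘ translate φ) (cubes n))
    ≡⟨ length-filter-complete (P? ∘ translate φ) (cubes-unique n) cubes-complete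
         copy-unique (InCopy-translate⇔∈ φ X p) ⟩
  length (map (proj₁ (translate φ p)) X)
    ≡⟨ length-map (proj₁ (translate φ p)) X ⟩
  length X
    ∎
  where
  open ≡-Reasoning
  P? : Decidable (λ ψ → InCopy X (proj₁ ψ) p)
  P? ψ = inCopy? X (proj₁ ψ) p
  copy-unique : Unique (map (proj₁ (translate φ p)) X)
  copy-unique = Unique.map⁺ (isometry-injective (proj₂ (translate φ p))) X!

mainTheorem3 : (k : ℕ) → 1 ≤ k → (X : List (Cube k)) → Unique X → X ≢ [] →
    (n : ℕ) → k ≤ n →
      Σ (List (Isometry k n)) (λ L → (p : Cube n) → coverCount X L p ≡ length X)
mainTheorem3 k _ X X! _ n k≤n =
  map (translate (zeroPad k≤n , zeroPad-isometry k≤n)) (cubes n) ,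
  coverCount-translates (zeroPad k≤n , zeroPad-isometry k≤n) X!
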